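{- Let $\phi$ be a formula not containing the operator $X_w$. If $\phi$ is satisfiable as an $\textit{LTL}_f$ formula (some finite trace in $\Sigma^*$ satisfies it), then $\phi$ is satisfiable as an LTL formula (some infinite trace in $\Sigma^\omega$ satisfies it).
   Context: Fix a finite set $\mathcal{P}$ of atomic propositions; $L=\mathcal{P}\cup\{\neg a: a\in\mathcal{P}\}$ is the set of literals and $\Sigma=2^{L}$. Formulas are in negation normal form: $\phi::=\mathsf{tt}\mid\mathsf{ff}\mid \ell\mid \phi\wedge\phi\mid\phi\vee\phi\mid X\phi\mid X_w\phi\mid \phi U\phi\mid\phi R\phi$, $\ell\in L$; $X_w$-free formulas are also LTL formulas. $\textit{LTL}_f$ semantics on nonempty finite traces $\eta=\omega_0\ldots\omega_n$ ($|\eta|=n+1$, $\eta_i=\omega_i\ldots\omega_n$): $\eta\models\mathsf{tt}$, $\eta\not\models\mathsf{ff}$; $\eta\models\ell$ iff $\ell\in\omega_0$; $\wedge,\vee$ as usual; $\eta\models X\psi$ iff $|\eta|>1$ and $\eta_1\models\psi$; $\eta\models X_w\psi$ iff $|\eta|=1$ or ($|\eta|>1$ and $\eta_1\models\psi$); $\eta\models\phi_1U\phi_2$ iff some $0\le i<|\eta|$ has $\eta_i\models\phi_2$ and $\eta_j\models\phi_1$ for all $j<i$; $\eta\models\phi_1R\phi_2$ iff either $\eta_i\models\phi_2$ for all $0\le i<|\eta|$, or some $0\le i<|\eta|$ has $\eta_i\models\phi_1$ and $\eta_j\models\phi_2$ for all $j\le i$. LTL semantics on infinite traces $\xi=\omega_0\omega_1\cdots$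 with suffixes $\xi_i$: $\xi\models\mathsf{tt}$, $\xi\not\models\mathsf{ff}$; $\xi\models\ell$ iff $\ell\in\omega_0$; $\wedge,\vee$ as usual; $\xi\models X\psi$ iff $\xi_1\models\psi$; $\xi\models\phi_1U\phi_2$ iff some $i\ge0$ has $\xi_i\models\phi_2$ and $\xi_j\models\phi_1$ for all $j<i$; $\xi\models\phi_1R\phi_2$ iff either $\xi_i\models\phi_2$ for all $i\ge0$, or some $i\ge0$ has $\xi_i\models\phi_1$ and $\xi_j\models\phi_2$ for all $j\le i$. -}

module Defs where

open import Data.Nat using (ℕ; _+_)
open import Data.Fin using (Fin; zero; suc; _<_)
open import Data.Bool using (Bool; true)
open import Data.List using ([]; _∷_)
open import Data.List.NonEmpty using (List⁺; _∷_; length)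
open import Data.Product using (Σ; _×_)
open import Data.Sum using (_⊎_)
open import Data.Unit using (⊤)
open import Data.Empty using (⊥)
open import Relation.Binary.PropositionalEquality using (_≡_)

data Literal (k : ℕ) : Set where
  pos : Fin k → Literal k
  neg : Fin k → Literal k

-- Σ = 2^L : a letter is an arbitrary subset of the literals.
Letter : ℕ → Set
Letter k = Literal k → Bool

_∈ₗ_ : {k : ℕ} → Literal k → Letter k → Set
ℓ ∈ₗ ω = ω ℓ ≡ true

-- Formulas in negation normal form.
data Formula (k : ℕ) : Set where
  tt ff   : Formula k
  lit     : Literal k → Formula k
  _∧_ _∨_ : Formula k → Formula k → Formula k
  X Xw    : Formula k → Formula k
  _U_ _R_ : Formula k → Formula k → Formula k

data XwFree {k : ℕ} : Formula k → Set where
  tt  : XwFree tt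
  ff  : XwFree ff
  lit : ∀ ℓ → XwFree (lit ℓ)
  _∧_ : ∀ {φ ψ} → XwFree φ → XwFree ψ → XwFree (φ ∧ ψ)
  _∨_ : ∀ {φ ψ} → XwFree φ → XwFree ψ → XwFree (φ ∨ ψ)
  X   : ∀ {φ} → XwFree φ → XwFree (X φ)
  _U_ : ∀ {φ ψ} → XwFree φ → XwFree ψ → XwFree (φ U ψ)
  _R_ : ∀ {φ ψ} → XwFree φ → XwFree ψ → XwFree (φ R ψ)

suffixᶠ : {A : Set} → (η : List⁺ A) → Fin (length η) → List⁺ A
suffixᶠ η zero = η
suffixᶠ (_ ∷ (b ∷ bs)) (suc i) = suffixᶠ (b ∷ bs) i

_⊨f_ : {k : ℕ} → List⁺ (Letter k) → Formula k → Set
η ⊨f tt = ⊤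
η ⊨f ff = ⊥
(ω ∷ _) ⊨f lit ℓ = ℓ ∈ₗ ω
η ⊨f (φ ∧ ψ) = (η ⊨f φ) × (η ⊨f ψ)
η ⊨f (φ ∨ ψ) = (η ⊨f φ) ⊎ (η ⊨f ψ)
(ω ∷ []) ⊨f X ψ = ⊥
(ω ∷ (ω′ ∷ ωs)) ⊨f X ψ = (ω′ ∷ ωs) ⊨f ψ
(ω ∷ []) ⊨f Xw ψ = ⊤
(ω ∷ (ω′ ∷ ωs)) ⊨f Xw ψ = (ω′ ∷ ωs) ⊨f ψ
η ⊨f (φ₁ U φ₂) =
  Σ (Fin (length η)) λ i → (suffixᶠ η i ⊨f φ₂)
    × (∀ (j : Fin (length η)) → j < i → suffixᶠ η j ⊨f φ₁)
η ⊨f (φ₁ R φ₂) =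
  (∀ (i : Fin (length η)) → suffixᶠ η i ⊨f φ₂)
  ⊎ Σ (Fin (length η)) λ i → (suffixᶠ η i ⊨f φ₁)
      × (∀ (j : Fin (length η)) → j Data.Fin.≤ i → suffixᶠ η j ⊨f φ₂)

suffixω : {A : Set} → (ℕ → A) → ℕ → (ℕ → A)
suffixω ξ i = λ n → ξ (i + n)

_⊨ω_ : {k : ℕ} → (ℕ → Letter k) → Formula k → Set
ξ ⊨ω tt = ⊤
ξ ⊨ω ff = ⊥
ξ ⊨ω lit ℓ = ℓ ∈ₗ ξ 0
ξ ⊨ω (φ ∧ ψ) = (ξ ⊨ω φ) × (ξ ⊨ω ψ)
ξ ⊨ω (φ ∨ ψ) = (ξ ⊨ω φ) ⊎ (ξ ⊨ω ψ)
ξ ⊨ω X ψ = suffixω ξ 1 ⊨ω ψ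
ξ ⊨ω Xw ψ = ⊥   -- X_w is not an LTL operator; only used on X_w-free formulas
ξ ⊨ω (φ₁ U φ₂) =
  Σ ℕ λ i → (suffixω ξ i ⊨ω φ₂)
    × (∀ (j : ℕ) → j Data.Nat.< i → suffixω ξ j ⊨ω φ₁)
ξ ⊨ω (φ₁ R φ₂) =
  (∀ (i : ℕ) → suffixω ξ i ⊨ω φ₂)
  ⊎ Σ ℕ λ i → (suffixω ξ i ⊨ω φ₁)
      × (∀ (j : ℕ) → j Data.Nat.≤ i → suffixω ξ j ⊨ω φ₂)

-- Extend the finite trace forever by repeating its last letter. By induction on
-- the formula, the extension satisfies every X_w-free formula that the finite
-- trace satisfies: the witnesses of X, U and of the second disjunct of R lie
-- inside the finite part, where both traces have the same suffixes, and for the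
-- first disjunct of R every suffix beyond the end coincides with the last one.
module Submission where

open import Defs
open import Data.Nat using (ℕ; zero; suc; _+_)
import Data.Nat as ℕ
open import Data.Nat.Properties using (<-trans; ≤-<-trans)
open import Data.Fin using (Fin; zero; suc; toℕ; fromℕ<)
open import Data.Fin.Properties using (toℕ<n; toℕ-fromℕ<)
open import Data.List using ([]; _∷_)
open import Data.List.NonEmpty using (List⁺; _∷_; length)
open import Data.Product using (Σ; _,_)
open import Data.Sum using (inj₁; inj₂)
open import Relation.Binary.PropositionalEquality
  using (_≗_; refl; sym; subst)

padWithLast : {A : Set} → List⁺ A → ℕ → A
padWithLast (a ∷ [])       _       = a
padWithLast (a ∷ (_ ∷ _))  zero    = a
padWithLast (_ ∷ (b ∷ bs)) (suc n) = padWithLast (b ∷ bs) n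

⊨ω-resp-≗ : {k : ℕ} (φ : Formula k) {ξ ξ′ : ℕ → Letter k} → ξ ≗ ξ′ → ξ ⊨ω φ → ξ′ ⊨ω φ
⊨ω-resp-≗ tt      e h = h
⊨ω-resp-≗ ff      e ()
⊨ω-resp-≗ (lit ℓ) e h = subst (λ ω → ℓ ∈ₗ ω) (e 0) h
⊨ω-resp-≗ (φ ∧ ψ) e (a , b) = ⊨ω-resp-≗ φ e a , ⊨ω-resp-≗ ψ e b
⊨ω-resp-≗ (φ ∨ ψ) e (inj₁ a) = inj₁ (⊨ω-resp-≗ φ e a)
⊨ω-resp-≗ (φ ∨ ψ) e (inj₂ b) = inj₂ (⊨ω-resp-≗ ψ e b)
⊨ω-resp-≗ (X φ)   e h = ⊨ω-resp-≗ φ (λ n → e (1 + n)) h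
⊨ω-resp-≗ (Xw φ)  e ()
⊨ω-resp-≗ (φ U ψ) e (i , a , b) =
  i , ⊨ω-resp-≗ ψ (λ n → e (i + n)) a ,
  λ j j<i → ⊨ω-resp-≗ φ (λ n → e (j + n)) (b j j<i)
⊨ω-resp-≗ (φ R ψ) e (inj₁ a) = inj₁ (λ i → ⊨ω-resp-≗ ψ (λ n → e (i + n)) (a i))
⊨ω-resp-≗ (φ R ψ) e (inj₂ (i , a , b)) =
  inj₂ (i , ⊨ω-resp-≗ φ (λ n → e (i + n)) a ,
        λ j j≤i → ⊨ω-resp-≗ ψ (λ n → e (j + n)) (b j j≤i))

padWithLast-suffixᶠ : {A : Set} (η : List⁺ A) (i : Fin (length η)) →
  padWithLast (suffixᶠ η i) ≗ suffixω (padWithLast η) (toℕ i)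
padWithLast-suffixᶠ η              zero    n = refl
padWithLast-suffixᶠ (_ ∷ (b ∷ bs)) (suc i) n = padWithLast-suffixᶠ (b ∷ bs) i n

suffixω-padWithLast : {A : Set} (η : List⁺ A) (i : ℕ) →
  Σ (Fin (length η)) λ j → padWithLast (suffixᶠ η j) ≗ suffixω (padWithLast η) i
suffixω-padWithLast (a ∷ [])       i       = zero , λ _ → refl
suffixω-padWithLast (a ∷ (_ ∷ _))  zero    = zero , λ _ → refl
suffixω-padWithLast (_ ∷ (b ∷ bs)) (suc i) with suffixω-padWithLast (b ∷ bs) i
... | j , e = suc j , e

⊨ω-suffixᶠ : {k : ℕ} (φ : Formula k) (η : List⁺ (Letter k)) (i : Fin (length η)) →
  padWithLast (suffixᶠ η i) ⊨ω φ → suffixω (padWithLast η) (toℕ i) ⊨ω φ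
⊨ω-suffixᶠ φ η i = ⊨ω-resp-≗ φ (padWithLast-suffixᶠ η i)

∀Fin⇒∀ℕ : {n : ℕ} (P Q : ℕ → Set) → (∀ {j} → Q j → j ℕ.< n) →
  (∀ (j : Fin n) → Q (toℕ j) → P (toℕ j)) → ∀ j → Q j → P j
∀Fin⇒∀ℕ P Q bound h j q =
  subst P (toℕ-fromℕ< j<n) (h (fromℕ< j<n) (subst Q (sym (toℕ-fromℕ< j<n)) q))
  where j<n = bound q

⊨f⇒padWithLast-⊨ω : {k : ℕ} (φ : Formula k) → XwFree φ →
  (η : List⁺ (Letter k)) → η ⊨f φ → padWithLast η ⊨ω φ
⊨f⇒padWithLast-⊨ω tt _ η h = h
⊨f⇒padWithLast-⊨ω ff _ η ()
⊨f⇒padWithLast-⊨ω (lit ℓ) _ (ω ∷ [])      h = h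
⊨f⇒padWithLast-⊨ω (lit ℓ) _ (ω ∷ (_ ∷ _)) h = h
⊨f⇒padWithLast-⊨ω (φ ∧ ψ) (fφ ∧ fψ) η (a , b) =
  ⊨f⇒padWithLast-⊨ω φ fφ η a , ⊨f⇒padWithLast-⊨ω ψ fψ η b
⊨f⇒padWithLast-⊨ω (φ ∨ ψ) (fφ ∨ fψ) η (inj₁ a) = inj₁ (⊨f⇒padWithLast-⊨ω φ fφ η a)
⊨f⇒padWithLast-⊨ω (φ ∨ ψ) (fφ ∨ fψ) η (inj₂ b) = inj₂ (⊨f⇒padWithLast-⊨ω ψ fψ η b)
⊨f⇒padWithLast-⊨ω (X φ) (X fφ) (ω ∷ [])        ()
⊨f⇒padWithLast-⊨ω (X φ) (X fφ) (ω ∷ (b ∷ bs)) h = ⊨f⇒padWithLast-⊨ω φ fφ (b ∷ bs) h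
⊨f⇒padWithLast-⊨ω (φ U ψ) (fφ U fψ) η (i , a , b) =
  toℕ i , ⊨ω-suffixᶠ ψ η i (⊨f⇒padWithLast-⊨ω ψ fψ _ a) ,
  ∀Fin⇒∀ℕ (λ j → suffixω (padWithLast η) j ⊨ω φ) (ℕ._< toℕ i) (λ j<i → <-trans j<i (toℕ<n i))
    (λ j j<i → ⊨ω-suffixᶠ φ η j (⊨f⇒padWithLast-⊨ω φ fφ _ (b j j<i)))
⊨f⇒padWithLast-⊨ω (φ R ψ) (fφ R fψ) η (inj₁ a) =
  inj₁ λ i → let (j , e) = suffixω-padWithLast η i in
    ⊨ω-resp-≗ ψ e (⊨f⇒padWithLast-⊨ω ψ fψ _ (a j))
⊨f⇒padWithLast-⊨ω (φ R ψ) (fφ R fψ) η (inj₂ (i , a , b)) =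
  inj₂ (toℕ i , ⊨ω-suffixᶠ φ η i (⊨f⇒padWithLast-⊨ω φ fφ _ a) ,
    ∀Fin⇒∀ℕ (λ j → suffixω (padWithLast η) j ⊨ω ψ) (ℕ._≤ toℕ i) (λ j≤i → ≤-<-trans j≤i (toℕ<n i))
      (λ j j≤i → ⊨ω-suffixᶠ ψ η j (⊨f⇒padWithLast-⊨ω ψ fψ _ (b j j≤i))))

theorem3 : {k : ℕ} (φ : Formula k) → XwFree φ
    → Σ (List⁺ (Letter k)) (λ η → η ⊨f φ)
    → Σ (ℕ → Letter k) (λ ξ → ξ ⊨ω φ)
theorem3 φ xwFree (η , η⊨φ) = padWithLast η , ⊨f⇒padWithLast-⊨ω φ xwFree η η⊨φ
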